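{- Let $S$ be a triangulated surface with sets of vertices, edges and faces $\mathcal V_0,\mathcal V_1,\mathcal V_2$, let $\mathcal V=\mathcal V_0\cup\mathcal V_1\cup\mathcal V_2$, and let $\mathcal N=\mathbb Z/12\mathbb Z$. (1) For any map $V:\mathcal V_0\to\mathcal N$ there is a unique vertex tonnetz $T$ on $S$ such that $[T(\rho)]=\{V(\rho)\}$ for every vertex $\rho\in\mathcal V_0$ and, for every face $\sigma\in\mathcal V_2$, $T(\sigma)$ is the multiset $\{V(\rho)\mid \rho\in\mathcal V_0,\ \rho<\sigma\}$ (values listed with multiplicity over the three vertices of $\sigma$). (2) For any map $E:\mathcal V_1\to\mathcal N$ there is a unique edge tonnetz $T$ on $S$ such that $[T(\tau)]=\{E(\tau)\}$ for every edge $\tau\in\mathcal V_1$.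
   Context: $\operatorname{Multisets}(\mathcal N)$ denotes the set of finite multisets with elements in $\mathcal N$. For a multiset $\mathcal C$, $|\mathcal C|$ is its order (counted with multiplicity) and $[\mathcal C]$ its underlying set (without multiplicities). For a set $\mathcal A$ and a multiset $\mathcal C$, a bijection $\phi:\mathcal A\to\mathcal C$ means a map $\phi:\mathcal A\to[\mathcal C]$ such that for each $c\in[\mathcal C]$ the cardinality of $\phi^{ -1}(c)$ equals the multiplicity of $c$ in $\mathcal C$. The set $\mathcal V$ of simplices is partially ordered by inclusion $\le$ (with $<$ strict inclusion), and $\tau\prec\sigma$ means $\tau\le\sigma$ with $\tau$ of codimension one in $\sigma$. A simplicial surface tonnetz (tonnetz) on $S$ is a map $T:\mathcal V\to\operatorname{Multisets}(\mathcal N)$ such that: (1) (downwards coherent) for every $\sigma\in\mathcal V_1\cup\mathcal V_2$ there exists a bijection $\partial_\sigma:\{\tau\mid\tau\prec\sigma\}\to T(\sigma)$ such that $\partial_\sigma(\tau)=N$ implies $N\in T(\tau)$; (2) (upwards coherent) for every $\rho\in\mathcal V_0\cup\mathcal V_1$ there exists a bijection $\Delta_\rho:\{\tau\mid\tau\succ\rho\}\to T(\rho)$ such that $\Delta_\rho(\tau)=N$ implies $N\in T(\tau)$. (Only existence of these bijections is required; they are not part of the data.) A tonnetz is a vertex tonnetz if $[T(\rho)]$ has exactly one element for every vertex $\rho\in\mathcal V_0$, and an edge tonnetz if $[T(\tau)]$ has exactly one element for every edge $\tau\in\mathcal V_1$. -}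

module Defs where

open import Data.Nat using (ℕ; zero; suc; _≟_; _≤_)
open import Data.Bool using (Bool; true; false; _∧_; _∨_; not; T)
open import Data.Fin using (Fin)
open import Data.Fin.Subset using (Subset; ∣_∣)
open import Data.Fin.Subset.Properties using (_⊆?_)
open import Data.List using (List)
open import Data.Bool.ListAction using (any)
open import Data.List.Relation.Unary.All using (All)
open import Data.Vec using (Vec; lookup)
open import Data.Product using (Σ; ∃; _×_; _,_; proj₁)
open import Relation.Nullary.Decidable using (⌊_⌋)
open import Relation.Binary.PropositionalEquality using (_≡_)
open import Function.Bundles using (_↔_)
open import Relation.Binary.Construct.Closure.ReflexiveTransitive using (Star)

-- Notes / 𝒩 = ℤ/12ℤ (only its underlying 12-element set matters)

N : Set
N = Fin 12

-- A finite multiset over 𝒩, given by its multiplicity function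
-- (multiplicity of x is  lookup C x).
Multiset : Set
Multiset = Vec ℕ 12

_∈ₘ_ : N → Multiset → Set
x ∈ₘ C = 1 ≤ lookup C x

-- "φ : A → C is a bijection" in the paper's sense: for every c,
-- the fibre φ⁻¹(c) has cardinality equal to the multiplicity of c in C.
IsBijectionTo : (A : Set) → (A → N) → Multiset → Set
IsBijectionTo A φ C = (c : N) → Fin (lookup C c) ↔ Σ A (λ a → φ a ≡ c)

SupportIs : Multiset → N → Set
SupportIs C x = (y : N) → (y ∈ₘ C → y ≡ x) × (y ≡ x → y ∈ₘ C)

SupportSingleton : Multiset → Set
SupportSingleton C = Σ N (λ x → SupportIs C x)

module Complex {n : ℕ} (faces : List (Subset n)) where

  isSimplex : Subset n → Bool
  isSimplex s = not ⌊ ∣ s ∣ ≟ 0 ⌋ ∧ any (λ f → ⌊ s ⊆? f ⌋) faces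

  Simplex : Set
  Simplex = Σ (Subset n) (λ s → T (isSimplex s))

  isDim : ℕ → Simplex → Bool
  isDim k (s , _) = ⌊ ∣ s ∣ ≟ suc k ⌋

  V₀ V₁ V₂ : Set
  V₀ = Σ Simplex (λ σ → T (isDim 0 σ))
  V₁ = Σ Simplex (λ σ → T (isDim 1 σ))
  V₂ = Σ Simplex (λ σ → T (isDim 2 σ))

  _<ᵇ_ : Simplex → Simplex → Bool
  (s , _) <ᵇ (t , _) = ⌊ s ⊆? t ⌋ ∧ not ⌊ ∣ s ∣ ≟ ∣ t ∣ ⌋

  _≺ᵇ_ : Simplex → Simplex → Bool
  (s , _) ≺ᵇ (t , _) = ⌊ s ⊆? t ⌋ ∧ ⌊ suc ∣ s ∣ ≟ ∣ t ∣ ⌋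

  Facets : Simplex → Set
  Facets σ = Σ Simplex (λ τ → T (τ ≺ᵇ σ))

  Cofacets : Simplex → Set
  Cofacets ρ = Σ Simplex (λ τ → T (ρ ≺ᵇ τ))

  VerticesBelow : Simplex → Set
  VerticesBelow σ = Σ V₀ (λ ρ → T (proj₁ ρ <ᵇ σ))

  LinkAdj : (ρ : Simplex) → Cofacets ρ → Cofacets ρ → Set
  LinkAdj ρ e e' = Σ Simplex (λ σ → T ((proj₁ e ≺ᵇ σ) ∧ (proj₁ e' ≺ᵇ σ)))

  EdgeAdj : V₀ → V₀ → Set
  EdgeAdj u v = Σ V₁ (λ e → T ((proj₁ u ≺ᵇ proj₁ e) ∧ (proj₁ v ≺ᵇ proj₁ e)))

  DownCoherentAt : (Simplex → Multiset) → Simplex → Set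
  DownCoherentAt t σ =
    Σ (Facets σ → N) λ ∂ →
      IsBijectionTo (Facets σ) ∂ (t σ) × ((τ : Facets σ) → ∂ τ ∈ₘ t (proj₁ τ))

  UpCoherentAt : (Simplex → Multiset) → Simplex → Set
  UpCoherentAt t ρ =
    Σ (Cofacets ρ → N) λ Δ →
      IsBijectionTo (Cofacets ρ) Δ (t ρ) × ((τ : Cofacets ρ) → Δ τ ∈ₘ t (proj₁ τ))

  IsTonnetz : (Simplex → Multiset) → Set
  IsTonnetz t =
    ((σ : Simplex) → T (isDim 1 σ ∨ isDim 2 σ) → DownCoherentAt t σ)
    × ((ρ : Simplex) → T (isDim 0 ρ ∨ isDim 1 ρ) → UpCoherentAt t ρ)

  IsVertexTonnetz : (Simplex → Multiset) → Set
  IsVertexTonnetz t = IsTonnetz t × ((ρ : V₀) → SupportSingleton (t (proj₁ ρ)))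

  IsEdgeTonnetz : (Simplex → Multiset) → Set
  IsEdgeTonnetz t = IsTonnetz t × ((τ : V₁) → SupportSingleton (t (proj₁ τ)))

record TriangulatedSurface (n : ℕ) : Set where
  field
    faces : List (Subset n)
  open Complex faces
  field
    faces-triangles : All (λ f → ∣ f ∣ ≡ 3) faces
    edge-two-faces  : (τ : V₁) → Fin 2 ↔ Cofacets (proj₁ τ)
    -- the link of every vertex is connected (hence a single cycle)
    link-connected  : (ρ : V₀) (e e' : Cofacets (proj₁ ρ)) →
                      Star (LinkAdj (proj₁ ρ)) e e'
    connected       : (u v : V₀) → Star EdgeAdj u v

module OnSurface {n : ℕ} (S : TriangulatedSurface n) where
  open TriangulatedSurface S public
  open Complex faces public

  VertexCond : (V₀ → N) → (Simplex → Multiset) → Set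
  VertexCond V t =
    IsVertexTonnetz t
    × ((ρ : V₀) → SupportIs (t (proj₁ ρ)) (V ρ))
    × ((σ : V₂) → IsBijectionTo (VerticesBelow (proj₁ σ)) (λ ρ → V (proj₁ ρ)) (t (proj₁ σ)))

  EdgeCond : (V₁ → N) → (Simplex → Multiset) → Set
  EdgeCond E t = IsEdgeTonnetz t × ((τ : V₁) → SupportIs (t (proj₁ τ)) (E τ))

  -- unique existence; uniqueness is pointwise (no function extensionality)
  ∃!ₜ : ((Simplex → Multiset) → Set) → Set
  ∃!ₜ P = Σ (Simplex → Multiset) λ t →
            P t × ((t' : Simplex → Multiset) → P t' → (σ : Simplex) → t' σ ≡ t σ)

{-# OPTIONS --safe #-}
-- Coherence says that each T(σ) is the image, counted with multiplicity, of a
-- finite set of neighbours of σ (its facets or its cofacets) under a labelling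
-- with values in the multisets of those neighbours.  Where these multisets are
-- singletons ({V ρ} at the vertices of a vertex tonnetz, {E τ} at the edges of
-- an edge tonnetz) the labelling is forced; together with the prescribed T at
-- the faces of a vertex tonnetz this determines T everywhere.  Conversely these
-- images define a tonnetz: the vertex tonnetz has V ρ with multiplicity deg ρ
-- at a vertex and the labels of the endpoints (resp. corners) at an edge (resp.
-- face); the edge tonnetz has the labels of the incident edges at a vertex,
-- E τ twice at an edge and the labels of the three sides at a face.  Coherence
-- uses that every vertex lies on an edge, every edge on exactly two faces, and
-- that the sides of a triangle can be matched bijectively with its corners,
-- each side with one of its own ends.
module Submission where

open import Defs
open import Axiom.UniquenessOfIdentityProofs.WithK using (uip)
open import Data.Bool using (Bool; T; not; _∨_)
open import Data.Bool.ListAction using (any)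
open import Data.Bool.Properties using (T-irrelevant; T?; T-∧; T-∨)
open import Data.Fin using (Fin; zero; suc; fromℕ<) renaming (_≟_ to _≟ᶠ_)
open import Data.Fin.Permutation using (↔⇒≡)
open import Data.Fin.Properties using (+↔⊎; *↔×; 0↔⊥; 1↔⊤; 2↔Bool; nonZeroIndex)
open import Data.Fin.Subset using (Subset; ∣_∣; _∈_; _∉_; _⊆_; _⊂_; ⁅_⁆; _-_; inside; outside)
open import Data.Fin.Subset.Properties
  using ( _∈?_; _⊆?_; _⊂?_; ⊆-trans; ⊆-antisym; p⊆q⇒∣p∣≤∣q∣; p⊂q⇒∣p∣<∣q∣; p─⊥≡p; p─q⊆p
        ; x∈⁅x⁆; x∈⁅y⁆⇒x≡y; ∣⁅x⁆∣≡1; x∈p∧x≢y⇒x∈p-y)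
open import Data.List using (List)
open import Data.List.Membership.Propositional using (find; lose) renaming (_∈_ to _∈ˡ_)
open import Data.List.Relation.Unary.All as All using (All)
open import Data.List.Relation.Unary.Any as Any using (Any)
open import Data.List.Relation.Unary.Any.Properties using (any⁺; any⁻)
open import Data.Nat using (ℕ; zero; suc; _+_; _*_; _≤_; _<_; s≤s; _≟_; >-nonZero⁻¹)
open import Data.Nat.Properties
  using (suc-injective; 1+n≢0; 0≢1+n; 1+n≢n; ≤-reflexive; ≤⇒≯; <⇒≢; n<1+n; m<n⇒m<1+n)
open import Data.Product using (Σ; _×_; _,_; proj₁; proj₂; uncurry)
open import Data.Product.Function.Dependent.Propositional using (Σ-↔)
open import Data.Product.Function.NonDependent.Propositional using (_×-↔_)
open import Data.Sum using (_⊎_; inj₁; inj₂; [_,_])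
open import Data.Sum.Function.Propositional using (_⊎-↔_)
open import Data.Vec using (Vec; []; _∷_; lookup; tabulate; here; there)
open import Data.Vec.Properties using (lookup∘tabulate; tabulate∘lookup; tabulate-cong)
open import Data.Vec.Properties.WithK using ([]=-irrelevant)
open import Function using (_∘_; const)
open import Function.Bundles using (_↔_; mk↔ₛ′; Inverse; Equivalence)
open import Function.Properties.Inverse using (↔-refl; ↔-sym; ↔-trans)
open import Relation.Binary.PropositionalEquality
  using (_≡_; _≢_; _≗_; refl; sym; trans; cong; subst; module ≡-Reasoning)
open import Relation.Nullary using (Dec; yes; no; Irrelevant; contradiction)
open import Relation.Nullary.Decidable
  using (⌊_⌋; True-↔; toWitness; fromWitness; toWitnessFalse; fromWitnessFalse)
open import Relation.Unary using (Decidable)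

Finite : Set → Set
Finite A = Σ ℕ λ k → Fin k ↔ A

Dec-finite : {A : Set} → Dec A → Irrelevant A → Finite A
Dec-finite a?@(yes _) irr = 1 , ↔-trans 1↔⊤ (True-↔ a? irr)
Dec-finite a?@(no _)  irr = 0 , ↔-trans 0↔⊥ (True-↔ a? irr)

Σ-Fin-suc↔ : ∀ {k} {P : Fin (suc k) → Set} → (P zero ⊎ Σ (Fin k) (P ∘ suc)) ↔ Σ (Fin (suc k)) P
Σ-Fin-suc↔ = mk↔ₛ′ [ (zero ,_) , (λ (i , p) → suc i , p) ]
  (λ { (zero , p) → inj₁ p ; (suc i , p) → inj₂ (i , p) })
  (λ { (zero , _) → refl ; (suc _ , _) → refl })
  (λ { (inj₁ _) → refl ; (inj₂ _) → refl })

Σ-Fin-finite : ∀ {k} {P : Fin k → Set} → Decidable P → (∀ i → Irrelevant (P i)) →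
               Finite (Σ (Fin k) P)
Σ-Fin-finite {zero}  _  _   = 0 , mk↔ₛ′ (λ ()) (λ ()) (λ ()) (λ ())
Σ-Fin-finite {suc k} P? irr =
  let a , P₀ = Dec-finite (P? zero) (irr zero)
      m , P₊ = Σ-Fin-finite (P? ∘ suc) (irr ∘ suc)
  in a + m , ↔-trans (+↔⊎ {a}) (↔-trans (P₀ ⊎-↔ P₊) Σ-Fin-suc↔)

Σ-finite : {A : Set} {P : A → Set} → Finite A → Decidable P → (∀ a → Irrelevant (P a)) →
           Finite (Σ A P)
Σ-finite (k , e) P? irr =
  let m , e′ = Σ-Fin-finite (P? ∘ Inverse.to e) (irr ∘ Inverse.to e)
  in m , ↔-trans e′ (Σ-↔ e ↔-refl)

Vec-∷↔× : ∀ {A : Set} {n} → (A × Vec A n) ↔ Vec A (suc n)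
Vec-∷↔× = mk↔ₛ′ (uncurry _∷_) (λ { (x ∷ xs) → x , xs }) (λ { (_ ∷ _) → refl }) (λ _ → refl)

Subset-finite : ∀ n → Finite (Subset n)
Subset-finite zero    = 1 , mk↔ₛ′ (λ _ → []) (λ _ → zero) (λ { [] → refl }) (λ { zero → refl })
Subset-finite (suc n) =
  let m , e = Subset-finite n
  in 2 * m , ↔-trans *↔× (↔-trans (2↔Bool ×-↔ e) Vec-∷↔×)

module _ {A : Set} {B : A → Bool} where

  T-Σ-finite : Finite A → Finite (Σ A (T ∘ B))
  T-Σ-finite fin = Σ-finite fin (T? ∘ B) (λ _ → T-irrelevant)

  T-Σ-≡ : {x y : Σ A (T ∘ B)} → proj₁ x ≡ proj₁ y → x ≡ y
  T-Σ-≡ {a , p} {.a , q} refl = cong (a ,_) (T-irrelevant p q)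

module _ {A : Set} where

  Fibre : (A → N) → N → Set
  Fibre f c = Σ A λ a → f a ≡ c

  Fibre-finite : Finite A → (f : A → N) (c : N) → Finite (Fibre f c)
  Fibre-finite fin f c = Σ-finite fin (λ a → f a ≟ᶠ c) (λ _ → uip)

  Fibre-cong : {f g : A → N} → f ≗ g → (c : N) → Fibre f c ↔ Fibre g c
  Fibre-cong f≗g c = Σ-↔ ↔-refl λ {a} →
    mk↔ₛ′ (trans (sym (f≗g a))) (trans (f≗g a)) (λ _ → uip _ _) (λ _ → uip _ _)

  multiset : Finite A → (A → N) → Multiset
  multiset fin f = tabulate (proj₁ ∘ Fibre-finite fin f)

  multiset-isBijection : (fin : Finite A) (f : A → N) → IsBijectionTo A f (multiset fin f)
  multiset-isBijection fin f c =
    subst (λ m → Fin m ↔ Fibre f c) (sym (lookup∘tabulate (proj₁ ∘ Fibre-finite fin f) c))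
      (proj₂ (Fibre-finite fin f c))

  IsBijectionTo-unique : {f g : A → N} {C D : Multiset} →
                         IsBijectionTo A f C → IsBijectionTo A g D → f ≗ g → C ≡ D
  IsBijectionTo-unique {C = C} {D} bijC bijD f≗g = begin
    C                   ≡⟨ tabulate∘lookup C ⟨
    tabulate (lookup C) ≡⟨ tabulate-cong lookup-C≗lookup-D ⟩
    tabulate (lookup D) ≡⟨ tabulate∘lookup D ⟩
    D                   ∎
    where
    open ≡-Reasoning
    lookup-C≗lookup-D : lookup C ≗ lookup D
    lookup-C≗lookup-D c = ↔⇒≡ (↔-trans (bijC c) (↔-trans (Fibre-cong f≗g c) (↔-sym (bijD c))))

  -- C is explicit below: it cannot be inferred from IsBijectionTo A f C, whose
  -- unfolding only mentions C under lookup.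
  module _ {f : A → N} (C : Multiset) (bij : IsBijectionTo A f C) where

    IsBijectionTo-∈ₘ : (a : A) → f a ∈ₘ C
    IsBijectionTo-∈ₘ a = >-nonZero⁻¹ _ {{nonZeroIndex (Inverse.from (bij (f a)) (a , refl))}}

    IsBijectionTo-∈ₘ⁻ : {c : N} → c ∈ₘ C → Fibre f c
    IsBijectionTo-∈ₘ⁻ c∈C = Inverse.to (bij _) (fromℕ< c∈C)

    IsBijectionTo-const : {x : N} → f ≗ const x → A → SupportIs C x
    IsBijectionTo-const f≗x a y =
      (λ y∈C → let a′ , fa′≡y = IsBijectionTo-∈ₘ⁻ y∈C in trans (sym fa′≡y) (f≗x a′)) ,
      (λ { refl → subst (_∈ₘ C) (f≗x a) (IsBijectionTo-∈ₘ a) })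

    IsBijectionTo-∘ : {B : Set} (e : B ↔ A) → IsBijectionTo B (f ∘ Inverse.to e) C
    IsBijectionTo-∘ e c = ↔-trans (bij c) (↔-sym (Σ-↔ e ↔-refl))

module _ {n : ℕ} where

  Elements : Subset n → Set
  Elements p = Σ (Fin n) (_∈ p)

  Elements-≡ : {p : Subset n} {x y : Elements p} → proj₁ x ≡ proj₁ y → x ≡ y
  Elements-≡ {x = x , x∈p} {.x , x∈p′} refl = cong (x ,_) ([]=-irrelevant x∈p x∈p′)

Fin∣p∣↔Elements : ∀ {n} (p : Subset n) → Fin ∣ p ∣ ↔ Elements p
Fin∣p∣↔Elements []            = mk↔ₛ′ (λ ()) (λ ()) (λ ()) (λ ())
Fin∣p∣↔Elements (outside ∷ p) = ↔-trans (Fin∣p∣↔Elements p)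
  (mk↔ₛ′ (λ (x , x∈p) → suc x , there x∈p) (λ { (suc x , there x∈p) → x , x∈p })
         (λ { (suc _ , there _) → refl }) (λ _ → refl))
Fin∣p∣↔Elements (inside ∷ p)  = mk↔ₛ′
  (λ { zero → zero , here ; (suc i) → let x , x∈p = to i in suc x , there x∈p })
  (λ { (zero , here) → zero ; (suc x , there x∈p) → suc (from (x , x∈p)) })
  (λ { (zero , here) → refl
     ; (suc x , there x∈p) → cong (λ (y , y∈p) → suc y , there y∈p) (strictlyInverseˡ _) })
  (λ { zero → refl ; (suc i) → cong suc (strictlyInverseʳ i) })
  where open Inverse (Fin∣p∣↔Elements p)

Elements↔Fin : ∀ {n m} {p : Subset n} → ∣ p ∣ ≡ m → Elements p ↔ Fin m
Elements↔Fin {p = p} refl = ↔-sym (Fin∣p∣↔Elements p)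

x∈p⇒suc∣p-x∣≡∣p∣ : ∀ {n} {p : Subset n} {x : Fin n} → x ∈ p → suc ∣ p - x ∣ ≡ ∣ p ∣
x∈p⇒suc∣p-x∣≡∣p∣ {p = inside  ∷ p} here        = cong (suc ∘ ∣_∣) (p─⊥≡p p)
x∈p⇒suc∣p-x∣≡∣p∣ {p = outside ∷ p} (there x∈p) = x∈p⇒suc∣p-x∣≡∣p∣ x∈p
x∈p⇒suc∣p-x∣≡∣p∣ {p = inside  ∷ p} (there x∈p) = cong suc (x∈p⇒suc∣p-x∣≡∣p∣ x∈p)

x∉p-x : ∀ {n} {p : Subset n} {x : Fin n} → x ∉ p - x
x∉p-x {p = _ ∷ _} {zero}  ()
x∉p-x {p = _ ∷ _} {suc _} (there x∈p-x) = x∉p-x x∈p-x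

module _ {n : ℕ} where

  x∈p-y⇒x≢y : {p : Subset n} {x y : Fin n} → x ∈ p - y → x ≢ y
  x∈p-y⇒x≢y x∈p-x refl = x∉p-x x∈p-x

  x∈p⇒⁅x⁆⊆p : {p : Subset n} {x : Fin n} → x ∈ p → ⁅ x ⁆ ⊆ p
  x∈p⇒⁅x⁆⊆p {x = x} x∈p y∈⁅x⁆ = subst (_∈ _) (sym (x∈⁅y⁆⇒x≡y x y∈⁅x⁆)) x∈p

  ⁅⁆-injective : {x y : Fin n} → ⁅ x ⁆ ≡ ⁅ y ⁆ → x ≡ y
  ⁅⁆-injective {x} {y} eq = x∈⁅y⁆⇒x≡y y (subst (x ∈_) eq (x∈⁅x⁆ x))

  p-x≡p-y⇒x≡y : {p : Subset n} {x y : Fin n} → x ∈ p → p - x ≡ p - y → x ≡ y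
  p-x≡p-y⇒x≡y {x = x} {y} x∈p eq with x ≟ᶠ y
  ... | yes x≡y = x≡y
  ... | no  x≢y = contradiction (subst (x ∈_) (sym eq) (x∈p∧x≢y⇒x∈p-y x∈p x≢y)) x∉p-x

  p⊆q⇒p≡q⊎p⊂q : {p q : Subset n} → p ⊆ q → p ≡ q ⊎ p ⊂ q
  p⊆q⇒p≡q⊎p⊂q {p} {q} p⊆q with p ⊂? q
  ... | yes p⊂q = inj₂ p⊂q
  ... | no  p⊄q = inj₁ (⊆-antisym p⊆q q⊆p)
    where
    q⊆p : q ⊆ p
    q⊆p {x} x∈q with x ∈? p
    ... | yes x∈p = x∈p
    ... | no  x∉p = contradiction ((λ {y} → p⊆q {y}) , x , x∈q , x∉p) p⊄q

  p⊆q∧∣q∣≤∣p∣⇒p≡q : {p q : Subset n} → p ⊆ q → ∣ q ∣ ≤ ∣ p ∣ → p ≡ q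
  p⊆q∧∣q∣≤∣p∣⇒p≡q p⊆q ∣q∣≤∣p∣ with p⊆q⇒p≡q⊎p⊂q p⊆q
  ... | inj₁ p≡q = p≡q
  ... | inj₂ p⊂q = contradiction (p⊂q⇒∣p∣<∣q∣ p⊂q) (≤⇒≯ ∣q∣≤∣p∣)

  p⊆q∧1+∣p∣≡∣q∣⇒p≡q-x : {p q : Subset n} → p ⊆ q → suc ∣ p ∣ ≡ ∣ q ∣ →
                         Σ (Elements q) λ (x , _) → p ≡ q - x
  p⊆q∧1+∣p∣≡∣q∣⇒p≡q-x {p} {q} p⊆q size with p⊆q⇒p≡q⊎p⊂q p⊆q
  ... | inj₁ refl = contradiction size 1+n≢n
  ... | inj₂ (_ , x , x∈q , x∉p) = (x , x∈q) , p⊆q∧∣q∣≤∣p∣⇒p≡q p⊆q-x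
          (≤-reflexive (suc-injective (trans (x∈p⇒suc∣p-x∣≡∣p∣ x∈q) (sym size))))
    where
    p⊆q-x : p ⊆ q - x
    p⊆q-x y∈p = x∈p∧x≢y⇒x∈p-y (p⊆q y∈p) (λ { refl → x∉p y∈p })

  ∣p∣≡1⇒p≡⁅x⁆ : {p : Subset n} → ∣ p ∣ ≡ 1 → Σ (Fin n) λ x → p ≡ ⁅ x ⁆
  ∣p∣≡1⇒p≡⁅x⁆ size =
    let x , x∈p = Inverse.from (Elements↔Fin size) zero
    in x , sym (p⊆q∧∣q∣≤∣p∣⇒p≡q (x∈p⇒⁅x⁆⊆p x∈p) (≤-reflexive (trans size (sym (∣⁅x⁆∣≡1 x)))))

next₃ : Fin 3 → Fin 3
next₃ zero             = suc zero
next₃ (suc zero)       = suc (suc zero)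
next₃ (suc (suc zero)) = zero

next₃-↔ : Fin 3 ↔ Fin 3
next₃-↔ = mk↔ₛ′ next₃ (next₃ ∘ next₃)
  (λ { zero → refl ; (suc zero) → refl ; (suc (suc zero)) → refl })
  (λ { zero → refl ; (suc zero) → refl ; (suc (suc zero)) → refl })

next₃-≢ : (i : Fin 3) → next₃ i ≢ i
next₃-≢ zero             ()
next₃-≢ (suc zero)       ()
next₃-≢ (suc (suc zero)) ()

derangement₃ : {A : Set} → A ↔ Fin 3 → Σ (A ↔ A) λ π → ∀ a → Inverse.to π a ≢ a
derangement₃ e = ↔-trans e (↔-trans next₃-↔ (↔-sym e)) ,
  λ a πa≡a → next₃-≢ (to a) (trans (sym (strictlyInverseˡ _)) (cong to πa≡a))
  where open Inverse e

module ComplexProperties {n : ℕ} (faces : List (Subset n)) where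
  open Complex faces

  ∣_∣ˢ : Simplex → ℕ
  ∣ σ ∣ˢ = ∣ proj₁ σ ∣

  isSimplex⁺ : {s : Subset n} → Any (s ⊆_) faces → ∣ s ∣ ≢ 0 → T (isSimplex s)
  isSimplex⁺ {s} s⊆face ∣s∣≢0 = Equivalence.from (T-∧ {not ⌊ ∣ s ∣ ≟ 0 ⌋})
    (fromWitnessFalse ∣s∣≢0 , any⁺ _ (Any.map fromWitness s⊆face))

  isSimplex⁻ : (σ : Simplex) → ∣ σ ∣ˢ ≢ 0 × Any (proj₁ σ ⊆_) faces
  isSimplex⁻ (s , s-simplex) =
    let ∣s∣≢0 , s⊆face = Equivalence.to (T-∧ {not ⌊ ∣ s ∣ ≟ 0 ⌋}) s-simplex
    in toWitnessFalse ∣s∣≢0 , Any.map toWitness (any⁻ _ faces s⊆face)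

  ⊆-isSimplex : {s : Subset n} (σ : Simplex) → s ⊆ proj₁ σ → ∣ s ∣ ≢ 0 → T (isSimplex s)
  ⊆-isSimplex σ s⊆σ = isSimplex⁺ (Any.map (⊆-trans s⊆σ) (proj₂ (isSimplex⁻ σ)))

  isDim-unique : {j k : ℕ} (σ : Simplex) → T (isDim j σ) → T (isDim k σ) → j ≡ k
  isDim-unique σ σ-dimʲ σ-dimᵏ = suc-injective (trans (sym (toWitness σ-dimʲ)) (toWitness σ-dimᵏ))

  _≺_ _<ˢ_ : Simplex → Simplex → Set
  τ ≺ σ  = proj₁ τ ⊆ proj₁ σ × suc ∣ τ ∣ˢ ≡ ∣ σ ∣ˢ
  τ <ˢ σ = proj₁ τ ⊆ proj₁ σ × ∣ τ ∣ˢ ≢ ∣ σ ∣ˢ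

  ≺ᵇ⇒≺ : (τ σ : Simplex) → T (τ ≺ᵇ σ) → τ ≺ σ
  ≺ᵇ⇒≺ τ σ τ≺σ =
    let τ⊆σ , size = Equivalence.to (T-∧ {⌊ proj₁ τ ⊆? proj₁ σ ⌋}) τ≺σ
    in toWitness τ⊆σ , toWitness size

  ≺⇒≺ᵇ : (τ σ : Simplex) → τ ≺ σ → T (τ ≺ᵇ σ)
  ≺⇒≺ᵇ τ σ (τ⊆σ , size) = Equivalence.from (T-∧ {⌊ proj₁ τ ⊆? proj₁ σ ⌋})
    (fromWitness (λ {x} → τ⊆σ {x}) , fromWitness size)

  <ᵇ⇒<ˢ : (τ σ : Simplex) → T (τ <ᵇ σ) → τ <ˢ σ
  <ᵇ⇒<ˢ τ σ τ<σ =
    let τ⊆σ , size = Equivalence.to (T-∧ {⌊ proj₁ τ ⊆? proj₁ σ ⌋}) τ<σ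
    in toWitness τ⊆σ , toWitnessFalse size

  <ˢ⇒<ᵇ : (τ σ : Simplex) → τ <ˢ σ → T (τ <ᵇ σ)
  <ˢ⇒<ᵇ τ σ (τ⊆σ , size) = Equivalence.from (T-∧ {⌊ proj₁ τ ⊆? proj₁ σ ⌋})
    (fromWitness (λ {x} → τ⊆σ {x}) , fromWitnessFalse size)

  ≺-≺⇒< : (υ τ σ : Simplex) → T (υ ≺ᵇ τ) → T (τ ≺ᵇ σ) → T (υ <ᵇ σ)
  ≺-≺⇒< υ τ σ υ≺τ τ≺σ =
    let υ⊆τ , size₁ = ≺ᵇ⇒≺ υ τ υ≺τ
        τ⊆σ , size₂ = ≺ᵇ⇒≺ τ σ τ≺σ
        ∣υ∣<∣σ∣ = subst (∣ υ ∣ˢ <_) (trans (cong suc size₁) size₂) (m<n⇒m<1+n (n<1+n _))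
    in <ˢ⇒<ᵇ υ σ (⊆-trans υ⊆τ τ⊆σ , <⇒≢ ∣υ∣<∣σ∣)

  facet-dim : {k : ℕ} (σ : Simplex) → T (isDim (suc k) σ) → (τ : Facets σ) → T (isDim k (proj₁ τ))
  facet-dim σ σ-dim (τ , τ≺σ) =
    fromWitness (suc-injective (trans (proj₂ (≺ᵇ⇒≺ τ σ τ≺σ)) (toWitness σ-dim)))

  cofacet-dim : {k : ℕ} (ρ : Simplex) → T (isDim k ρ) → (τ : Cofacets ρ) → T (isDim (suc k) (proj₁ τ))
  cofacet-dim ρ ρ-dim (τ , ρ≺τ) =
    fromWitness (trans (sym (proj₂ (≺ᵇ⇒≺ ρ τ ρ≺τ))) (cong suc (toWitness ρ-dim)))

  Simplex-finite : Finite Simplex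
  Simplex-finite = T-Σ-finite (Subset-finite n)

  Facets-finite : (σ : Simplex) → Finite (Facets σ)
  Facets-finite σ = T-Σ-finite Simplex-finite

  Cofacets-finite : (ρ : Simplex) → Finite (Cofacets ρ)
  Cofacets-finite ρ = T-Σ-finite Simplex-finite

  VerticesBelow-finite : (σ : Simplex) → Finite (VerticesBelow σ)
  VerticesBelow-finite σ = T-Σ-finite (T-Σ-finite Simplex-finite)

  module _ {k : ℕ} (σ : Simplex) (σ-size : ∣ σ ∣ˢ ≡ suc (suc k)) where

    opposite-facet : Elements (proj₁ σ) → Facets σ
    opposite-facet (x , x∈σ) = facet , ≺⇒≺ᵇ facet σ (p─q⊆p _ _ , x∈p⇒suc∣p-x∣≡∣p∣ x∈σ)
      where
      ∣σ-x∣≢0 : ∣ proj₁ σ - x ∣ ≢ 0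
      ∣σ-x∣≢0 = 1+n≢0 ∘ trans (sym (suc-injective (trans (x∈p⇒suc∣p-x∣≡∣p∣ x∈σ) σ-size)))
      facet : Simplex
      facet = proj₁ σ - x , ⊆-isSimplex σ (p─q⊆p _ _) ∣σ-x∣≢0

    opposite-vertex : (τ : Facets σ) →
                      Σ (Elements (proj₁ σ)) λ (x , _) → proj₁ (proj₁ τ) ≡ proj₁ σ - x
    opposite-vertex (τ , τ≺σ) = let τ⊆σ , τ-size = ≺ᵇ⇒≺ τ σ τ≺σ in p⊆q∧1+∣p∣≡∣q∣⇒p≡q-x τ⊆σ τ-size

    Facets↔Elements : Facets σ ↔ Elements (proj₁ σ)
    Facets↔Elements = mk↔ₛ′ (proj₁ ∘ opposite-vertex) opposite-facet
      (λ (x , x∈σ) → Elements-≡ (sym (p-x≡p-y⇒x≡y x∈σ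
                        (proj₂ (opposite-vertex (opposite-facet (x , x∈σ)))))))
      (λ τ → T-Σ-≡ (T-Σ-≡ (sym (proj₂ (opposite-vertex τ)))))

    vertex-below : Elements (proj₁ σ) → VerticesBelow σ
    vertex-below (x , x∈σ) = (vertex , fromWitness (∣⁅x⁆∣≡1 x)) , <ˢ⇒<ᵇ vertex σ (x∈p⇒⁅x⁆⊆p x∈σ , 1≢∣σ∣)
      where
      vertex : Simplex
      vertex = ⁅ x ⁆ , ⊆-isSimplex σ (x∈p⇒⁅x⁆⊆p x∈σ) (1+n≢0 ∘ trans (sym (∣⁅x⁆∣≡1 x)))
      1≢∣σ∣ : ∣ ⁅ x ⁆ ∣ ≢ ∣ σ ∣ˢ
      1≢∣σ∣ eq = 0≢1+n (suc-injective (trans (sym (∣⁅x⁆∣≡1 x)) (trans eq σ-size)))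

    vertex-of : (ρ : VerticesBelow σ) → Σ (Elements (proj₁ σ)) λ (x , _) → proj₁ (proj₁ (proj₁ ρ)) ≡ ⁅ x ⁆
    vertex-of (((ρ , ρ-simplex) , ρ-dim) , ρ<σ) =
      let x , ρ≡⁅x⁆ = ∣p∣≡1⇒p≡⁅x⁆ (toWitness ρ-dim)
      in (x , proj₁ (<ᵇ⇒<ˢ (ρ , ρ-simplex) σ ρ<σ) (subst (x ∈_) (sym ρ≡⁅x⁆) (x∈⁅x⁆ x))) , ρ≡⁅x⁆

    VerticesBelow↔Elements : VerticesBelow σ ↔ Elements (proj₁ σ)
    VerticesBelow↔Elements = mk↔ₛ′ (proj₁ ∘ vertex-of) vertex-below
      (λ x → Elements-≡ (sym (⁅⁆-injective (proj₂ (vertex-of (vertex-below x))))))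
      (λ ρ → T-Σ-≡ (T-Σ-≡ (T-Σ-≡ (sym (proj₂ (vertex-of ρ))))))

  -- The side opposite a corner x is matched with the next corner in a cyclic order
  -- of the three corners; being different from x, that corner lies on the side.
  orientation : (σ : Simplex) → T (isDim 2 σ) →
                Σ (Facets σ ↔ VerticesBelow σ) λ ψ → ∀ τ → T (proj₁ (proj₁ (Inverse.to ψ τ)) ≺ᵇ proj₁ τ)
  orientation σ σ-dim = ψ , ψ-≺
    where
    σ-size = toWitness σ-dim
    rotation = derangement₃ (Elements↔Fin σ-size)
    ψ = ↔-trans (Facets↔Elements σ σ-size)
          (↔-trans (proj₁ rotation) (↔-sym (VerticesBelow↔Elements σ σ-size)))
    vertex≺facet : (x y : Elements (proj₁ σ)) → y ≢ x →
                   T (proj₁ (proj₁ (vertex-below σ σ-size y)) ≺ᵇ proj₁ (opposite-facet σ σ-size x))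
    vertex≺facet x y y≢x =
      ≺⇒≺ᵇ (proj₁ (proj₁ (vertex-below σ σ-size y))) (proj₁ (opposite-facet σ σ-size x))
      ( x∈p⇒⁅x⁆⊆p (x∈p∧x≢y⇒x∈p-y (proj₂ y) (y≢x ∘ Elements-≡))
      , trans (cong suc (∣⁅x⁆∣≡1 (proj₁ y)))
              (sym (suc-injective (trans (x∈p⇒suc∣p-x∣≡∣p∣ (proj₂ x)) σ-size))))
    ψ-≺ : ∀ τ → T (proj₁ (proj₁ (Inverse.to ψ τ)) ≺ᵇ proj₁ τ)
    ψ-≺ τ = subst (λ τ′ → T (proj₁ (proj₁ (Inverse.to ψ τ)) ≺ᵇ proj₁ τ′))
              (Inverse.strictlyInverseʳ (Facets↔Elements σ σ-size) τ)
              (vertex≺facet x (Inverse.to (proj₁ rotation) x) (proj₂ rotation x))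
      where x = Inverse.to (Facets↔Elements σ σ-size) τ

  module Pure (triangles : All (λ f → ∣ f ∣ ≡ 3) faces) where

    containing-triangle : (σ : Simplex) → Σ (Subset n) λ f → f ∈ˡ faces × proj₁ σ ⊆ f × ∣ f ∣ ≡ 3
    containing-triangle σ =
      let f , f∈faces , σ⊆f = find (proj₂ (isSimplex⁻ σ))
      in f , f∈faces , σ⊆f , All.lookup triangles f∈faces

    ∣σ∣≤3 : (σ : Simplex) → ∣ σ ∣ˢ ≤ 3
    ∣σ∣≤3 σ = let _ , _ , σ⊆f , ∣f∣≡3 = containing-triangle σ
              in subst (∣ σ ∣ˢ ≤_) ∣f∣≡3 (p⊆q⇒∣p∣≤∣q∣ σ⊆f)

    data Dimension (σ : Simplex) : Set where
      vertex : T (isDim 0 σ) → Dimension σ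
      edge   : T (isDim 1 σ) → Dimension σ
      face   : T (isDim 2 σ) → Dimension σ

    dimension : (σ : Simplex) → Dimension σ
    dimension σ with ∣ σ ∣ˢ in σ-size | proj₁ (isSimplex⁻ σ) | ∣σ∣≤3 σ
    ... | 0 | ∣σ∣≢0 | _ = contradiction refl ∣σ∣≢0
    ... | 1 | _ | _ = vertex (fromWitness σ-size)
    ... | 2 | _ | _ = edge (fromWitness σ-size)
    ... | 3 | _ | _ = face (fromWitness σ-size)
    ... | suc (suc (suc (suc _))) | _ | s≤s (s≤s (s≤s ()))

    -- A vertex x lies in a triangle f; removing from f a corner y ≠ x leaves an edge through x.
    vertex-cofacet : (ρ : V₀) → Cofacets (proj₁ ρ)
    vertex-cofacet (ρ , ρ-dim) =
      let f , f∈faces , ρ⊆f , ∣f∣≡3 = containing-triangle ρ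
          x , ρ≡⁅x⁆ = ∣p∣≡1⇒p≡⁅x⁆ (toWitness ρ-dim)
          x∈f = ρ⊆f (subst (x ∈_) (sym ρ≡⁅x⁆) (x∈⁅x⁆ x))
          ∣f-x∣≡2 = suc-injective (trans (x∈p⇒suc∣p-x∣≡∣p∣ x∈f) ∣f∣≡3)
          y , y∈f-x = Inverse.from (Elements↔Fin ∣f-x∣≡2) zero
          y∈f = p─q⊆p f ⁅ x ⁆ y∈f-x
          ∣f-y∣≡2 = suc-injective (trans (x∈p⇒suc∣p-x∣≡∣p∣ y∈f) ∣f∣≡3)
          x∈f-y = x∈p∧x≢y⇒x∈p-y x∈f (x∈p-y⇒x≢y y∈f-x ∘ sym)
          edge = f - y , isSimplex⁺ (lose f∈faces (p─q⊆p f ⁅ y ⁆)) (1+n≢0 ∘ trans (sym ∣f-y∣≡2))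
      in edge , ≺⇒≺ᵇ ρ edge
        ( (λ z∈ρ → subst (_∈ f - y) (sym (x∈⁅y⁆⇒x≡y x (subst (_ ∈_) ρ≡⁅x⁆ z∈ρ))) x∈f-y)
        , trans (cong suc (toWitness ρ-dim)) (sym ∣f-y∣≡2))

    module _ {A : Set} (f₀ : V₀ → A) (f₁ : V₁ → A) (f₂ : V₂ → A) where

      bySimplexDim : Simplex → A
      bySimplexDim σ with dimension σ
      ... | vertex σ-dim = f₀ (σ , σ-dim)
      ... | edge   σ-dim = f₁ (σ , σ-dim)
      ... | face   σ-dim = f₂ (σ , σ-dim)

      bySimplexDim-V₀ : (ρ : V₀) → bySimplexDim (proj₁ ρ) ≡ f₀ ρ
      bySimplexDim-V₀ (ρ , ρ-dim) with dimension ρ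
      ... | vertex ρ-dim′ = cong f₀ (T-Σ-≡ refl)
      ... | edge   ρ-dim′ = contradiction (isDim-unique ρ ρ-dim ρ-dim′) λ ()
      ... | face   ρ-dim′ = contradiction (isDim-unique ρ ρ-dim ρ-dim′) λ ()

      bySimplexDim-V₁ : (τ : V₁) → bySimplexDim (proj₁ τ) ≡ f₁ τ
      bySimplexDim-V₁ (τ , τ-dim) with dimension τ
      ... | vertex τ-dim′ = contradiction (isDim-unique τ τ-dim τ-dim′) λ ()
      ... | edge   τ-dim′ = cong f₁ (T-Σ-≡ refl)
      ... | face   τ-dim′ = contradiction (isDim-unique τ τ-dim τ-dim′) λ ()

      bySimplexDim-V₂ : (σ : V₂) → bySimplexDim (proj₁ σ) ≡ f₂ σ
      bySimplexDim-V₂ (σ , σ-dim) with dimension σ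
      ... | vertex σ-dim′ = contradiction (isDim-unique σ σ-dim σ-dim′) λ ()
      ... | edge   σ-dim′ = contradiction (isDim-unique σ σ-dim σ-dim′) λ ()
      ... | face   σ-dim′ = cong f₂ (T-Σ-≡ refl)

module Tonnetze {n : ℕ} (S : TriangulatedSurface n) where
  open OnSurface S
  open ComplexProperties faces
  open Pure faces-triangles

  edge-Cofacets↔Facets : (τ : V₁) → Cofacets (proj₁ τ) ↔ Facets (proj₁ τ)
  edge-Cofacets↔Facets (τ , τ-dim) = ↔-trans (↔-sym (edge-two-faces (τ , τ-dim)))
    (↔-sym (↔-trans (Facets↔Elements τ (toWitness τ-dim)) (Elements↔Fin (toWitness τ-dim))))

  IsTonnetz-intro : (t : Simplex → Multiset) →
                    ((τ : V₁) → DownCoherentAt t (proj₁ τ)) → ((σ : V₂) → DownCoherentAt t (proj₁ σ)) →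
                    ((ρ : V₀) → UpCoherentAt t (proj₁ ρ)) → ((τ : V₁) → UpCoherentAt t (proj₁ τ)) →
                    IsTonnetz t
  IsTonnetz-intro t down-at-edge down-at-face up-at-vertex up-at-edge = down , up
    where
    down : (σ : Simplex) → T (isDim 1 σ ∨ isDim 2 σ) → DownCoherentAt t σ
    down σ σ-dim with Equivalence.to (T-∨ {isDim 1 σ}) σ-dim
    ... | inj₁ edge-dim = down-at-edge (σ , edge-dim)
    ... | inj₂ face-dim = down-at-face (σ , face-dim)
    up : (ρ : Simplex) → T (isDim 0 ρ ∨ isDim 1 ρ) → UpCoherentAt t ρ
    up ρ ρ-dim with Equivalence.to (T-∨ {isDim 0 ρ}) ρ-dim
    ... | inj₁ vertex-dim = up-at-vertex (ρ , vertex-dim)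
    ... | inj₂ edge-dim   = up-at-edge (ρ , edge-dim)

  module _ (t : Simplex → Multiset) (t-tonnetz : IsTonnetz t) where

    down-at-edge : (τ : V₁) → DownCoherentAt t (proj₁ τ)
    down-at-edge (τ , τ-dim) = proj₁ t-tonnetz τ (Equivalence.from (T-∨ {isDim 1 τ}) (inj₁ τ-dim))

    down-at-face : (σ : V₂) → DownCoherentAt t (proj₁ σ)
    down-at-face (σ , σ-dim) = proj₁ t-tonnetz σ (Equivalence.from (T-∨ {isDim 1 σ}) (inj₂ σ-dim))

    up-at-vertex : (ρ : V₀) → UpCoherentAt t (proj₁ ρ)
    up-at-vertex (ρ , ρ-dim) = proj₂ t-tonnetz ρ (Equivalence.from (T-∨ {isDim 0 ρ}) (inj₁ ρ-dim))

    up-at-edge : (τ : V₁) → UpCoherentAt t (proj₁ τ)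
    up-at-edge (τ , τ-dim) = proj₂ t-tonnetz τ (Equivalence.from (T-∨ {isDim 0 τ}) (inj₂ τ-dim))

  module VertexTonnetz (V : V₀ → N) where

    endpoint-label : (τ : V₁) → Facets (proj₁ τ) → N
    endpoint-label (τ , τ-dim) ρ = V (proj₁ ρ , facet-dim τ τ-dim ρ)

    -- The tonnetz is used only through tonnetz-at-vertex, tonnetz-at-edge and tonnetz-at-face.
    abstract

      at-vertex : V₀ → Multiset
      at-vertex ρ = multiset (Cofacets-finite (proj₁ ρ)) (const (V ρ))

      at-edge : V₁ → Multiset
      at-edge τ = multiset (Facets-finite (proj₁ τ)) (endpoint-label τ)

      at-face : V₂ → Multiset
      at-face σ = multiset (VerticesBelow-finite (proj₁ σ)) (V ∘ proj₁)

      tonnetz : Simplex → Multiset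
      tonnetz = bySimplexDim at-vertex at-edge at-face

      tonnetz-at-vertex : (ρ : V₀) → IsBijectionTo (Cofacets (proj₁ ρ)) (const (V ρ)) (tonnetz (proj₁ ρ))
      tonnetz-at-vertex ρ = subst (IsBijectionTo _ _) (sym (bySimplexDim-V₀ at-vertex at-edge at-face ρ))
        (multiset-isBijection (Cofacets-finite (proj₁ ρ)) (const (V ρ)))

      tonnetz-at-edge : (τ : V₁) → IsBijectionTo (Facets (proj₁ τ)) (endpoint-label τ) (tonnetz (proj₁ τ))
      tonnetz-at-edge τ = subst (IsBijectionTo _ _) (sym (bySimplexDim-V₁ at-vertex at-edge at-face τ))
        (multiset-isBijection (Facets-finite (proj₁ τ)) (endpoint-label τ))

      tonnetz-at-face : (σ : V₂) → IsBijectionTo (VerticesBelow (proj₁ σ)) (V ∘ proj₁) (tonnetz (proj₁ σ))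
      tonnetz-at-face σ = subst (IsBijectionTo _ _) (sym (bySimplexDim-V₂ at-vertex at-edge at-face σ))
        (multiset-isBijection (VerticesBelow-finite (proj₁ σ)) (V ∘ proj₁))

    tonnetz-down-at-edge : (τ : V₁) → DownCoherentAt tonnetz (proj₁ τ)
    tonnetz-down-at-edge (τ , τ-dim) = endpoint-label (τ , τ-dim) , tonnetz-at-edge (τ , τ-dim) ,
      λ ρ → IsBijectionTo-∈ₘ (tonnetz (proj₁ ρ)) (tonnetz-at-vertex (proj₁ ρ , facet-dim τ τ-dim ρ))
              (τ , proj₂ ρ)

    tonnetz-down-at-face : (σ : V₂) → DownCoherentAt tonnetz (proj₁ σ)
    tonnetz-down-at-face (σ , σ-dim) =
      V ∘ proj₁ ∘ Inverse.to ψ , IsBijectionTo-∘ (tonnetz σ) (tonnetz-at-face (σ , σ-dim)) ψ ,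
      λ τ → subst (_∈ₘ tonnetz (proj₁ τ)) (cong V (T-Σ-≡ refl))
              (IsBijectionTo-∈ₘ (tonnetz (proj₁ τ)) (tonnetz-at-edge (proj₁ τ , facet-dim σ σ-dim τ))
                 (proj₁ (proj₁ (Inverse.to ψ τ)) , ψ-≺ τ))
      where
      ψ = proj₁ (orientation σ σ-dim)
      ψ-≺ = proj₂ (orientation σ σ-dim)

    tonnetz-up-at-vertex : (ρ : V₀) → UpCoherentAt tonnetz (proj₁ ρ)
    tonnetz-up-at-vertex (ρ , ρ-dim) = const (V (ρ , ρ-dim)) , tonnetz-at-vertex (ρ , ρ-dim) ,
      λ τ → subst (_∈ₘ tonnetz (proj₁ τ)) (cong V (T-Σ-≡ refl))
              (IsBijectionTo-∈ₘ (tonnetz (proj₁ τ)) (tonnetz-at-edge (proj₁ τ , cofacet-dim ρ ρ-dim τ))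
                 (ρ , proj₂ τ))

    tonnetz-up-at-edge : (τ : V₁) → UpCoherentAt tonnetz (proj₁ τ)
    tonnetz-up-at-edge (τ , τ-dim) =
      endpoint-label (τ , τ-dim) ∘ Inverse.to ι ,
      IsBijectionTo-∘ (tonnetz τ) (tonnetz-at-edge (τ , τ-dim)) ι ,
      λ σ → let ρ , ρ≺τ = Inverse.to ι σ in
        IsBijectionTo-∈ₘ (tonnetz (proj₁ σ)) (tonnetz-at-face (proj₁ σ , cofacet-dim τ τ-dim σ))
          ((ρ , facet-dim τ τ-dim (ρ , ρ≺τ)) , ≺-≺⇒< ρ τ (proj₁ σ) ρ≺τ (proj₂ σ))
      where
      ι = edge-Cofacets↔Facets (τ , τ-dim)

    support : (ρ : V₀) → SupportIs (tonnetz (proj₁ ρ)) (V ρ)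
    support ρ =
      IsBijectionTo-const (tonnetz (proj₁ ρ)) (tonnetz-at-vertex ρ) (λ _ → refl) (vertex-cofacet ρ)

    satisfies : VertexCond V tonnetz
    satisfies =
      ( IsTonnetz-intro tonnetz
          tonnetz-down-at-edge tonnetz-down-at-face tonnetz-up-at-vertex tonnetz-up-at-edge
      , λ ρ → V ρ , support ρ)
      , support , tonnetz-at-face

    unique : (t : Simplex → Multiset) → VertexCond V t → (σ : Simplex) → t σ ≡ tonnetz σ
    unique t ((t-tonnetz , _) , t-support , t-at-face) σ with dimension σ
    ... | vertex σ-dim =
      let Δ , Δ-bij , _ = up-at-vertex t t-tonnetz (σ , σ-dim)
      in IsBijectionTo-unique Δ-bij (tonnetz-at-vertex (σ , σ-dim))
           (λ τ → proj₁ (t-support (σ , σ-dim) (Δ τ)) (IsBijectionTo-∈ₘ (t σ) Δ-bij τ))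
    ... | edge σ-dim =
      let ∂ , ∂-bij , ∂-mem = down-at-edge t t-tonnetz (σ , σ-dim)
      in IsBijectionTo-unique ∂-bij (tonnetz-at-edge (σ , σ-dim))
           (λ ρ → proj₁ (t-support (proj₁ ρ , facet-dim σ σ-dim ρ) (∂ ρ)) (∂-mem ρ))
    ... | face σ-dim =
      IsBijectionTo-unique (t-at-face (σ , σ-dim)) (tonnetz-at-face (σ , σ-dim)) (λ _ → refl)

  module EdgeTonnetz (E : V₁ → N) where

    edge-label : (ρ : V₀) → Cofacets (proj₁ ρ) → N
    edge-label (ρ , ρ-dim) τ = E (proj₁ τ , cofacet-dim ρ ρ-dim τ)

    side-label : (σ : V₂) → Facets (proj₁ σ) → N
    side-label (σ , σ-dim) τ = E (proj₁ τ , facet-dim σ σ-dim τ)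

    abstract

      at-vertex : V₀ → Multiset
      at-vertex ρ = multiset (Cofacets-finite (proj₁ ρ)) (edge-label ρ)

      at-edge : V₁ → Multiset
      at-edge τ = multiset (Cofacets-finite (proj₁ τ)) (const (E τ))

      at-face : V₂ → Multiset
      at-face σ = multiset (Facets-finite (proj₁ σ)) (side-label σ)

      tonnetz : Simplex → Multiset
      tonnetz = bySimplexDim at-vertex at-edge at-face

      tonnetz-at-vertex : (ρ : V₀) → IsBijectionTo (Cofacets (proj₁ ρ)) (edge-label ρ) (tonnetz (proj₁ ρ))
      tonnetz-at-vertex ρ = subst (IsBijectionTo _ _) (sym (bySimplexDim-V₀ at-vertex at-edge at-face ρ))
        (multiset-isBijection (Cofacets-finite (proj₁ ρ)) (edge-label ρ))

      tonnetz-at-edge : (τ : V₁) → IsBijectionTo (Cofacets (proj₁ τ)) (const (E τ)) (tonnetz (proj₁ τ))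
      tonnetz-at-edge τ = subst (IsBijectionTo _ _) (sym (bySimplexDim-V₁ at-vertex at-edge at-face τ))
        (multiset-isBijection (Cofacets-finite (proj₁ τ)) (const (E τ)))

      tonnetz-at-face : (σ : V₂) → IsBijectionTo (Facets (proj₁ σ)) (side-label σ) (tonnetz (proj₁ σ))
      tonnetz-at-face σ = subst (IsBijectionTo _ _) (sym (bySimplexDim-V₂ at-vertex at-edge at-face σ))
        (multiset-isBijection (Facets-finite (proj₁ σ)) (side-label σ))

    tonnetz-down-at-edge : (τ : V₁) → DownCoherentAt tonnetz (proj₁ τ)
    tonnetz-down-at-edge (τ , τ-dim) =
      const (E (τ , τ-dim)) , IsBijectionTo-∘ (tonnetz τ) (tonnetz-at-edge (τ , τ-dim)) (↔-sym ι) ,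
      λ ρ → subst (_∈ₘ tonnetz (proj₁ ρ)) (cong E (T-Σ-≡ refl))
              (IsBijectionTo-∈ₘ (tonnetz (proj₁ ρ)) (tonnetz-at-vertex (proj₁ ρ , facet-dim τ τ-dim ρ))
                 (τ , proj₂ ρ))
      where
      ι = edge-Cofacets↔Facets (τ , τ-dim)

    tonnetz-down-at-face : (σ : V₂) → DownCoherentAt tonnetz (proj₁ σ)
    tonnetz-down-at-face (σ , σ-dim) = side-label (σ , σ-dim) , tonnetz-at-face (σ , σ-dim) ,
      λ τ → IsBijectionTo-∈ₘ (tonnetz (proj₁ τ)) (tonnetz-at-edge (proj₁ τ , facet-dim σ σ-dim τ))
              (σ , proj₂ τ)

    tonnetz-up-at-vertex : (ρ : V₀) → UpCoherentAt tonnetz (proj₁ ρ)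
    tonnetz-up-at-vertex (ρ , ρ-dim) = edge-label (ρ , ρ-dim) , tonnetz-at-vertex (ρ , ρ-dim) ,
      λ τ → let τ′ = proj₁ τ , cofacet-dim ρ ρ-dim τ in
        IsBijectionTo-∈ₘ (tonnetz (proj₁ τ)) (tonnetz-at-edge τ′) (Inverse.to (edge-two-faces τ′) zero)

    tonnetz-up-at-edge : (τ : V₁) → UpCoherentAt tonnetz (proj₁ τ)
    tonnetz-up-at-edge (τ , τ-dim) = const (E (τ , τ-dim)) , tonnetz-at-edge (τ , τ-dim) ,
      λ σ → subst (_∈ₘ tonnetz (proj₁ σ)) (cong E (T-Σ-≡ refl))
              (IsBijectionTo-∈ₘ (tonnetz (proj₁ σ)) (tonnetz-at-face (proj₁ σ , cofacet-dim τ τ-dim σ))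
                 (τ , proj₂ σ))

    support : (τ : V₁) → SupportIs (tonnetz (proj₁ τ)) (E τ)
    support τ = IsBijectionTo-const (tonnetz (proj₁ τ)) (tonnetz-at-edge τ) (λ _ → refl)
                  (Inverse.to (edge-two-faces τ) zero)

    satisfies : EdgeCond E tonnetz
    satisfies =
      ( IsTonnetz-intro tonnetz
          tonnetz-down-at-edge tonnetz-down-at-face tonnetz-up-at-vertex tonnetz-up-at-edge
      , λ τ → E τ , support τ)
      , support

    unique : (t : Simplex → Multiset) → EdgeCond E t → (σ : Simplex) → t σ ≡ tonnetz σ
    unique t ((t-tonnetz , _) , t-support) σ with dimension σ
    ... | vertex σ-dim =
      let Δ , Δ-bij , Δ-mem = up-at-vertex t t-tonnetz (σ , σ-dim)
      in IsBijectionTo-unique Δ-bij (tonnetz-at-vertex (σ , σ-dim))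
           (λ τ → proj₁ (t-support (proj₁ τ , cofacet-dim σ σ-dim τ) (Δ τ)) (Δ-mem τ))
    ... | edge σ-dim =
      let Δ , Δ-bij , _ = up-at-edge t t-tonnetz (σ , σ-dim)
      in IsBijectionTo-unique Δ-bij (tonnetz-at-edge (σ , σ-dim))
           (λ τ → proj₁ (t-support (σ , σ-dim) (Δ τ)) (IsBijectionTo-∈ₘ (t σ) Δ-bij τ))
    ... | face σ-dim =
      let ∂ , ∂-bij , ∂-mem = down-at-face t t-tonnetz (σ , σ-dim)
      in IsBijectionTo-unique ∂-bij (tonnetz-at-face (σ , σ-dim))
           (λ τ → proj₁ (t-support (proj₁ τ , facet-dim σ σ-dim τ) (∂ τ)) (∂-mem τ))

lemma2p6 : {n : ℕ} (S : TriangulatedSurface n) →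
    ((V : OnSurface.V₀ S → N) → OnSurface.∃!ₜ S (OnSurface.VertexCond S V))
    × ((E : OnSurface.V₁ S → N) → OnSurface.∃!ₜ S (OnSurface.EdgeCond S E))
lemma2p6 S =
  (λ V → let open Tonnetze.VertexTonnetz S V in tonnetz , satisfies , unique) ,
  (λ E → let open Tonnetze.EdgeTonnetz S E in tonnetz , satisfies , unique)
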